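{- Let $w$ be a non-empty operation sequence. Then there is a unique way to decompose $w$ as \[w=x_{1}w_{1}x_{2}w_{2}\cdots x_{2m-1}w_{2m-1}x_{2m}v,\] where $m\in\mathbb{Z}_{>0}$, each $x_i\in\{I_1,O_1,I_2,O_2\}$, the word $x_1x_2\cdots x_{2m}$ is an unbreakable operation sequence, each $w_i$ is a (possibly empty) tsip word, and $v$ is a (possibly empty) operation sequence.
   Context: An operation sequence is a word over $\{I_1,I_2,O_1,O_2\}$ with equally many letters $I_1,I_2$ in total as letters $O_1,O_2$, and every prefix containing at least as many $I$ letters ($I_1$ or $I_2$) as $O$ letters ($O_1$ or $O_2$). A tsip word is an operation sequence such that for each $j\in\{1,2\}$ the numbers of $I_j$ and $O_j$ are equal and every prefix contains at least as many $I_j$ as $O_j$. A tsip sub-word of $w$ is a contiguous factor of $w$ that is a tsip word. A non-empty operation sequence is unbreakable if it contains no non-empty tsip sub-word other than possibly itself, and no non-empty proper prefix of it has equally many $I$ letters as $O$ letters (i.e. the deque is never empty during the corresponding procedure except at the start and end). -}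

module Defs where

open import Data.Nat using (ℕ; zero; suc; _+_; _*_; _≤_; _<_)
open import Data.Fin using (Fin)
open import Data.List using (List; []; _∷_; _++_; length; concatMap)
open import Data.Product using (_×_; _,_; ∃; ∃-syntax; Σ-syntax)
open import Relation.Binary.PropositionalEquality using (_≡_)
open import Relation.Nullary using (¬_)
open import Data.Unit using (⊤)

-- Letters: I j and O j for j ∈ {1,2} (represented by Fin 2).
data Letter : Set where
  I : Fin 2 → Letter
  O : Fin 2 → Letter

Word : Set
Word = List Letter

#I : Word → ℕ
#I [] = 0
#I (I _ ∷ w) = suc (#I w)
#I (O _ ∷ w) = #I w

#O : Word → ℕ
#O [] = 0
#O (I _ ∷ w) = #O w
#O (O _ ∷ w) = suc (#O w)

open import Data.Fin using (_≟_)
open import Relation.Nullary using (yes; no)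

#Ij : Fin 2 → Word → ℕ
#Ij j [] = 0
#Ij j (I k ∷ w) with j ≟ k
... | yes _ = suc (#Ij j w)
... | no _ = #Ij j w
#Ij j (O _ ∷ w) = #Ij j w

#Oj : Fin 2 → Word → ℕ
#Oj j [] = 0
#Oj j (I _ ∷ w) = #Oj j w
#Oj j (O k ∷ w) with j ≟ k
... | yes _ = suc (#Oj j w)
... | no _ = #Oj j w

IsOpSeq : Word → Set
IsOpSeq w = (#I w ≡ #O w) × (∀ p s → p ++ s ≡ w → #O p ≤ #I p)

IsTsip : Word → Set
IsTsip w = (∀ j → #Ij j w ≡ #Oj j w)
         × (∀ j p s → p ++ s ≡ w → #Oj j p ≤ #Ij j p)

NonEmpty : Word → Set
NonEmpty w = ¬ (w ≡ [])

IsTsipSubWord : Word → Word → Set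
IsTsipSubWord u w = IsTsip u × ∃[ a ] ∃[ b ] (a ++ u ++ b ≡ w)

IsUnbreakable : Word → Set
IsUnbreakable w =
  IsOpSeq w × NonEmpty w
  × (∀ u → NonEmpty u → IsTsipSubWord u w → u ≡ w)
  × (∀ p s → p ++ s ≡ w → NonEmpty p → NonEmpty s → ¬ (#I p ≡ #O p))

-- A candidate decomposition  w = x₁ w₁ x₂ w₂ ⋯ x_{2m-1} w_{2m-1} x_{2m} v :
--   pairs = [(x₁,w₁), …, (x_{2m-1},w_{2m-1})], lastX = x_{2m}, rest = v.
record Decomp : Set where
  constructor decomp
  field
    m     : ℕ
    pairs : List (Letter × Word)
    lastX : Letter
    rest  : Word
open Decomp public

letters : List (Letter × Word) → Word
letters [] = []
letters ((x , _) ∷ ps) = x ∷ letters ps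

flatten : List (Letter × Word) → Word
flatten [] = []
flatten ((x , u) ∷ ps) = x ∷ u ++ flatten ps

AllTsip : List (Letter × Word) → Set
AllTsip [] = ⊤
AllTsip ((_ , u) ∷ ps) = IsTsip u × AllTsip ps

IsDecompOf : Word → Decomp → Set
IsDecompOf w d =
  (0 < m d)
  × (suc (length (pairs d)) ≡ 2 * m d)
  × IsUnbreakable (letters (pairs d) ++ lastX d ∷ [])
  × AllTsip (pairs d)
  × IsOpSeq (rest d)
  × (flatten (pairs d) ++ lastX d ∷ rest d ≡ w)

-- The decomposition is forced by heights (number of I minus number of O).  An
-- unbreakable word x₁x₂⋯x₂ₘ has positive height strictly inside; inserting the tsip
-- words wᵢ keeps the heights at the letters xᵢ and never drops below them inside a
-- wᵢ, so x₁w₁⋯x₂ₘ must be the shortest nonempty balanced prefix P of w.  Writing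
-- P = x₁ Q x₂ₘ, what remains is to write Q = w₁ x₂ w₂ ⋯ x₂ₘ₋₁ w₂ₘ₋₁ with tsip wᵢ
-- and tsip-free x₂⋯x₂ₘ₋₁.  Such a reduction of Q exists, built greedily from the
-- right, and is unique: once expanded, a tsip-free word has no nonempty tsip
-- prefix, which pins down w₁, and the rest follows by induction.

module Submission where

open import Defs
open import Data.Empty using (⊥-elim)
open import Data.Fin using (Fin; zero; suc; _≟_)
open import Data.Fin.Properties using (all?)
open import Data.Integer as ℤ using (ℤ; +_; 0ℤ; 1ℤ; -1ℤ; _+_; _-_; _≤_; _<_)
import Data.Integer.Properties as ℤP
open import Data.Integer.Tactic.RingSolver using (solve-∀)
open import Data.List using (List; []; _∷_; _++_; _∷ʳ_; [_]; length; initLast; _∷ʳ′_)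
open import Data.List.Properties
  using (++-assoc; ++-identityʳ; ++-conicalˡ; ++-conicalʳ; ++-cancelˡ; length-++; ∷-injective; ∷ʳ-injective)
open import Data.Nat as ℕ using (ℕ)
import Data.Nat.Properties as ℕP
open import Data.Product using (Σ; ∃!; ∃; ∃₂; _×_; _,_; proj₁; proj₂)
open import Data.Sum using (_⊎_; inj₁; inj₂)
open import Data.Unit using (tt)
open import Relation.Nullary using (¬_; Dec; yes; no)
open import Relation.Nullary.Decidable using (_×-dec_)
open import Relation.Binary.PropositionalEquality using (_≡_; _≢_; refl; sym; trans; cong; cong₂; subst)
open Relation.Binary.PropositionalEquality.≡-Reasoning

module _ {a} {A : Set a} where

  ++-prefix-cases : ∀ (xs : List A) {ys} p {s} → p ++ s ≡ xs ++ ys →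
    (∃ λ t → p ++ t ≡ xs × s ≡ t ++ ys) ⊎ (∃ λ u → p ≡ xs ++ u × u ++ s ≡ ys)
  ++-prefix-cases []       p       eq = inj₂ (p , refl , eq)
  ++-prefix-cases (x ∷ xs) []      eq = inj₁ (x ∷ xs , refl , eq)
  ++-prefix-cases (x ∷ xs) (y ∷ p) eq with ∷-injective eq
  ... | refl , eq′ with ++-prefix-cases xs p eq′
  ... | inj₁ (t , p++t≡xs , s≡t++ys) = inj₁ (t , cong (x ∷_) p++t≡xs , s≡t++ys)
  ... | inj₂ (u , p≡xs++u , u++s≡ys) = inj₂ (u , cong (x ∷_) p≡xs++u , u++s≡ys)

  ∷ʳ-≢-[] : ∀ xs (x : A) → xs ∷ʳ x ≢ []
  ∷ʳ-≢-[] []      x ()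
  ∷ʳ-≢-[] (_ ∷ _) x ()

  prefix-of-∷ʳ : ∀ p {s} xs (x : A) → p ++ s ≡ xs ∷ʳ x → s ≢ [] → ∃ λ t → p ++ t ≡ xs
  prefix-of-∷ʳ p xs x eq s≢[] with ++-prefix-cases xs p eq
  ... | inj₁ (t , p++t≡xs , _) = t , p++t≡xs
  ... | inj₂ ([] , p≡xs++[] , _) = [] , trans (++-identityʳ p) (trans p≡xs++[] (++-identityʳ xs))
  ... | inj₂ (_ ∷ u , _ , u++s≡[x]) = ⊥-elim (s≢[] (++-conicalʳ u _ (proj₂ (∷-injective u++s≡[x]))))

  AllPrefixes : (List A → Set) → List A → Set a
  AllPrefixes P xs = ∀ p s → p ++ s ≡ xs → P p

  NoProperPrefix : (List A → Set) → List A → Set a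
  NoProperPrefix P xs = ∀ p s → p ++ s ≡ xs → s ≢ [] → ¬ P p

  allPrefixes? : {P : List A → Set} → (∀ p → Dec (P p)) → ∀ xs → Dec (AllPrefixes P xs)
  allPrefixes? {P} P? [] with P? []
  ... | yes P[] = yes λ p s eq → subst P (sym (++-conicalˡ p s eq)) P[]
  ... | no ¬P[] = no λ all → ¬P[] (all [] [] refl)
  allPrefixes? {P} P? (x ∷ xs) with P? [] | allPrefixes? (λ p → P? (x ∷ p)) xs
  ... | no ¬P[] | _        = no λ all → ¬P[] (all [] (x ∷ xs) refl)
  ... | yes _   | no ¬rest = no λ all → ¬rest λ p s eq → all (x ∷ p) s (cong (x ∷_) eq)
  ... | yes P[] | yes rest = yes all
    where
    all : AllPrefixes P (x ∷ xs)
    all []      s eq = P[]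
    all (_ ∷ p) s eq with ∷-injective eq
    ... | refl , eq′ = rest p s eq′

  shortestPrefix : {P : List A → Set} → (∀ p → Dec (P p)) → ∀ xs →
    (∃₂ λ p s → p ++ s ≡ xs × P p × NoProperPrefix P p) ⊎ (∀ p s → p ++ s ≡ xs → ¬ P p)
  shortestPrefix P? xs with P? []
  ... | yes P[] = inj₁ ([] , xs , refl , P[] , λ p s eq s≢[] → ⊥-elim (s≢[] (++-conicalʳ p s eq)))
  shortestPrefix {P} P? [] | no ¬P[] = inj₂ λ p s eq → subst (λ p → ¬ P p) (sym (++-conicalˡ p s eq)) ¬P[]
  shortestPrefix {P} P? (x ∷ xs) | no ¬P[] with shortestPrefix (λ p → P? (x ∷ p)) xs
  ... | inj₁ (p , s , eq , Pp , shortest) = inj₁ (x ∷ p , s , cong (x ∷_) eq , Pp , shortest′)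
    where
    shortest′ : NoProperPrefix P (x ∷ p)
    shortest′ []       s eq s≢[] = ¬P[]
    shortest′ (_ ∷ p′) s eq s≢[] with ∷-injective eq
    ... | refl , eq′ = shortest p′ s eq′ s≢[]
  ... | inj₂ none = inj₂ none′
    where
    none′ : ∀ p s → p ++ s ≡ x ∷ xs → ¬ P p
    none′ []      s eq = ¬P[]
    none′ (_ ∷ p) s eq with ∷-injective eq
    ... | refl , eq′ = none p s eq′

-- Heights and Dyck words

i≤i+nonneg : ∀ i {j} → 0ℤ ≤ j → i ≤ i + j
i≤i+nonneg i 0≤j = ℤP.≤-trans (ℤP.≤-reflexive (sym (ℤP.+-identityʳ i))) (ℤP.+-monoʳ-≤ i 0≤j)

weight : (Letter → ℤ) → Word → ℤ
weight f []      = 0ℤ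
weight f (x ∷ w) = f x + weight f w

weight-++ : ∀ f a b → weight f (a ++ b) ≡ weight f a + weight f b
weight-++ f []      b = sym (ℤP.+-identityˡ _)
weight-++ f (x ∷ a) b = trans (cong (_+_ (f x)) (weight-++ f a b)) (sym (ℤP.+-assoc (f x) _ _))

weight-cancel : ∀ f {u} → weight f u ≡ 0ℤ → ∀ a b → weight f (a ++ u ++ b) ≡ weight f (a ++ b)
weight-cancel f {u} u≡0 a b = begin
  weight f (a ++ u ++ b)                ≡⟨ weight-++ f a (u ++ b) ⟩
  weight f a + weight f (u ++ b)        ≡⟨ cong (_+_ (weight f a)) (weight-++ f u b) ⟩
  weight f a + (weight f u + weight f b) ≡⟨ cong (λ h → weight f a + (h + weight f b)) u≡0 ⟩
  weight f a + (0ℤ + weight f b)        ≡⟨ cong (_+_ (weight f a)) (ℤP.+-identityˡ (weight f b)) ⟩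
  weight f a + weight f b               ≡⟨ sym (weight-++ f a b) ⟩
  weight f (a ++ b)                     ∎

weight-pointwise-+ : ∀ {f g h} → (∀ x → h x ≡ f x + g x) → ∀ w → weight h w ≡ weight f w + weight g w
weight-pointwise-+ h≡f+g [] = refl
weight-pointwise-+ {f} {g} h≡f+g (x ∷ w)
  rewrite h≡f+g x | weight-pointwise-+ h≡f+g w = interchange (f x) (g x) _ _
  where
  interchange : ∀ a b c d → (a + b) + (c + d) ≡ (a + c) + (b + d)
  interchange = solve-∀

δ : Letter → ℤ
δ (I _) = 1ℤ
δ (O _) = -1ℤ

δ[_] : Fin 2 → Letter → ℤ
δ[ j ] (I k) with j ≟ k
... | yes _ = 1ℤ
... | no  _ = 0ℤ
δ[ j ] (O k) with j ≟ k
... | yes _ = -1ℤ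
... | no  _ = 0ℤ

δ≡δ₀+δ₁ : ∀ x → δ x ≡ δ[ zero ] x + δ[ suc zero ] x
δ≡δ₀+δ₁ (I zero)       = refl
δ≡δ₀+δ₁ (I (suc zero)) = refl
δ≡δ₀+δ₁ (O zero)       = refl
δ≡δ₀+δ₁ (O (suc zero)) = refl

height : Word → ℤ
height = weight δ

private
  1+[i-j]≡[1+i]-j : ∀ i j → 1ℤ + (i - j) ≡ (1ℤ + i) - j
  1+[i-j]≡[1+i]-j = solve-∀
  -1+[i-j]≡i-[1+j] : ∀ i j → -1ℤ + (i - j) ≡ i - (1ℤ + j)
  -1+[i-j]≡i-[1+j] = solve-∀

height≡#I-#O : ∀ w → height w ≡ + #I w - + #O w
height≡#I-#O []        = refl
height≡#I-#O (I _ ∷ w) rewrite height≡#I-#O w = 1+[i-j]≡[1+i]-j (+ #I w) (+ #O w)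
height≡#I-#O (O _ ∷ w) rewrite height≡#I-#O w = -1+[i-j]≡i-[1+j] (+ #I w) (+ #O w)

weight-δ[]≡#Ij-#Oj : ∀ j w → weight δ[ j ] w ≡ + #Ij j w - + #Oj j w
weight-δ[]≡#Ij-#Oj j [] = refl
weight-δ[]≡#Ij-#Oj j (I k ∷ w) with j ≟ k
... | yes _ rewrite weight-δ[]≡#Ij-#Oj j w = 1+[i-j]≡[1+i]-j (+ #Ij j w) (+ #Oj j w)
... | no  _ = trans (ℤP.+-identityˡ _) (weight-δ[]≡#Ij-#Oj j w)
weight-δ[]≡#Ij-#Oj j (O k ∷ w) with j ≟ k
... | yes _ rewrite weight-δ[]≡#Ij-#Oj j w = -1+[i-j]≡i-[1+j] (+ #Ij j w) (+ #Oj j w)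
... | no  _ = trans (ℤP.+-identityˡ _) (weight-δ[]≡#Ij-#Oj j w)

Dyck : (Letter → ℤ) → Word → Set
Dyck f w = weight f w ≡ 0ℤ × AllPrefixes (λ p → 0ℤ ≤ weight f p) w

CountDyck : (Word → ℕ) → (Word → ℕ) → Word → Set
CountDyck ι ο w = ι w ≡ ο w × AllPrefixes (λ p → ο p ℕ.≤ ι p) w

module _ (f : Letter → ℤ) (ι ο : Word → ℕ) (weight≡ι-ο : ∀ w → weight f w ≡ + ι w - + ο w) where

  balanced⇒weight≡0 : ∀ {w} → ι w ≡ ο w → weight f w ≡ 0ℤ
  balanced⇒weight≡0 {w} ι≡ο = trans (weight≡ι-ο w) (ℤP.i≡j⇒i-j≡0 (cong +_ ι≡ο))

  weight≡0⇒balanced : ∀ {w} → weight f w ≡ 0ℤ → ι w ≡ ο w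
  weight≡0⇒balanced {w} w≡0 = ℤP.+-injective (ℤP.i-j≡0⇒i≡j _ _ (trans (sym (weight≡ι-ο w)) w≡0))

  countDyck⇒Dyck : ∀ {w} → CountDyck ι ο w → Dyck f w
  countDyck⇒Dyck (ι≡ο , ο≤ι) =
    balanced⇒weight≡0 ι≡ο ,
    λ p s eq → subst (0ℤ ≤_) (sym (weight≡ι-ο p)) (ℤP.i≤j⇒0≤j-i (ℤ.+≤+ (ο≤ι p s eq)))

  Dyck⇒countDyck : ∀ {w} → Dyck f w → CountDyck ι ο w
  Dyck⇒countDyck (w≡0 , 0≤) =
    weight≡0⇒balanced w≡0 ,
    λ p s eq → ℤP.drop‿+≤+ (ℤP.0≤i-j⇒j≤i (subst (0ℤ ≤_) (weight≡ι-ο p) (0≤ p s eq)))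

opSeq⇒Dyck : ∀ {w} → IsOpSeq w → Dyck δ w
opSeq⇒Dyck {w} = countDyck⇒Dyck δ #I #O height≡#I-#O {w}

Dyck⇒opSeq : ∀ {w} → Dyck δ w → IsOpSeq w
Dyck⇒opSeq {w} = Dyck⇒countDyck δ #I #O height≡#I-#O {w}

balanced⇒height≡0 : ∀ w → #I w ≡ #O w → height w ≡ 0ℤ
balanced⇒height≡0 w = balanced⇒weight≡0 δ #I #O height≡#I-#O {w}

height≡0⇒balanced : ∀ w → height w ≡ 0ℤ → #I w ≡ #O w
height≡0⇒balanced w = weight≡0⇒balanced δ #I #O height≡#I-#O {w}

Tsipℤ : Word → Set
Tsipℤ w = ∀ j → Dyck δ[ j ] w

tsip⇒Tsipℤ : ∀ {w} → IsTsip w → Tsipℤ w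
tsip⇒Tsipℤ {w} (balanced , prefixes) j =
  countDyck⇒Dyck δ[ j ] (#Ij j) (#Oj j) (weight-δ[]≡#Ij-#Oj j) {w} (balanced j , prefixes j)

Tsipℤ⇒tsip : ∀ {w} → Tsipℤ w → IsTsip w
Tsipℤ⇒tsip {w} t = (λ j → proj₁ (counts j)) , (λ j → proj₂ (counts j))
  where
  counts : ∀ j → CountDyck (#Ij j) (#Oj j) w
  counts j = Dyck⇒countDyck δ[ j ] (#Ij j) (#Oj j) (weight-δ[]≡#Ij-#Oj j) (t j)

Dyck-[] : ∀ {f} → Dyck f []
Dyck-[] {f} = refl , λ p s eq → subst (λ p → 0ℤ ≤ weight f p) (sym (++-conicalˡ p s eq)) ℤP.≤-refl

Dyck-+ : ∀ {f g h w} → (∀ x → h x ≡ f x + g x) → Dyck f w → Dyck g w → Dyck h w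
Dyck-+ {w = w} h≡f+g (f≡0 , f≥0) (g≡0 , g≥0) =
  trans (weight-pointwise-+ h≡f+g w) (cong₂ _+_ f≡0 g≡0) ,
  λ p s eq → subst (0ℤ ≤_) (sym (weight-pointwise-+ h≡f+g p)) (ℤP.+-mono-≤ (f≥0 p s eq) (g≥0 p s eq))

Dyck-delete : ∀ {f} a {u b} → Dyck f (a ++ u ++ b) → Dyck f u → Dyck f (a ++ b)
Dyck-delete {f} a {u} {b} (total , prefixes) (u≡0 , _) =
  trans (sym (weight-cancel f u≡0 a b)) total , prefixes′
  where
  prefixes′ : AllPrefixes (λ p → 0ℤ ≤ weight f p) (a ++ b)
  prefixes′ p s eq with ++-prefix-cases a p eq
  ... | inj₁ (t , p++t≡a , _) =
        prefixes p (t ++ u ++ b) (trans (sym (++-assoc p t (u ++ b))) (cong (_++ u ++ b) p++t≡a))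
  ... | inj₂ (b₁ , refl , b₁++s≡b) = subst (0ℤ ≤_) (weight-cancel f u≡0 a b₁)
        (prefixes (a ++ u ++ b₁) s (begin
          (a ++ u ++ b₁) ++ s   ≡⟨ ++-assoc a (u ++ b₁) s ⟩
          a ++ (u ++ b₁) ++ s   ≡⟨ cong (a ++_) (++-assoc u b₁ s) ⟩
          a ++ u ++ b₁ ++ s     ≡⟨ cong (λ b′ → a ++ u ++ b′) b₁++s≡b ⟩
          a ++ u ++ b           ∎))

Dyck-insert : ∀ {f} a {u b} → Dyck f (a ++ b) → Dyck f u → Dyck f (a ++ u ++ b)
Dyck-insert {f} a {u} {b} (total , prefixes) (u≡0 , uprefixes) =
  trans (weight-cancel f u≡0 a b) total , prefixes′
  where
  prefixes′ : AllPrefixes (λ p → 0ℤ ≤ weight f p) (a ++ u ++ b)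
  prefixes′ p s eq with ++-prefix-cases a p eq
  ... | inj₁ (t , p++t≡a , _) = prefixes p (t ++ b) (trans (sym (++-assoc p t b)) (cong (_++ b) p++t≡a))
  ... | inj₂ (c , refl , c++s≡u++b) with ++-prefix-cases u c c++s≡u++b
  ...   | inj₁ (t , c++t≡u , _) = subst (0ℤ ≤_) (sym (weight-++ f a c))
          (ℤP.+-mono-≤ (prefixes a b refl) (uprefixes c t c++t≡u))
  ...   | inj₂ (b₁ , refl , b₁++s≡b) = subst (0ℤ ≤_) (sym (weight-cancel f u≡0 a b₁))
          (prefixes (a ++ b₁) s (trans (++-assoc a b₁ s) (cong (a ++_) b₁++s≡b)))

Dyck-++⁻ˡ : ∀ {f} a {b} → Dyck f (a ++ b) → 0ℤ ≤ weight f b → Dyck f a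
Dyck-++⁻ˡ {f} a {b} (total , prefixes) 0≤b =
  ℤP.≤-antisym a≤0 (prefixes a b refl) ,
  λ p s eq → prefixes p (s ++ b) (trans (sym (++-assoc p s b)) (cong (_++ b) eq))
  where
  a≤0 : weight f a ≤ 0ℤ
  a≤0 = ℤP.≤-trans (i≤i+nonneg (weight f a) 0≤b) (ℤP.≤-reflexive (trans (sym (weight-++ f a b)) total))

tsip⇒Dyck : ∀ {w} → IsTsip w → Dyck δ w
tsip⇒Dyck t = Dyck-+ δ≡δ₀+δ₁ (tsip⇒Tsipℤ t zero) (tsip⇒Tsipℤ t (suc zero))

Tsipℤ-[] : Tsipℤ []
Tsipℤ-[] j = Dyck-[]

Tsipℤ-delete : ∀ a {u b} → Tsipℤ (a ++ u ++ b) → Tsipℤ u → Tsipℤ (a ++ b)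
Tsipℤ-delete a t tu j = Dyck-delete a (t j) (tu j)

Tsipℤ-insert : ∀ a {u b} → Tsipℤ (a ++ b) → Tsipℤ u → Tsipℤ (a ++ u ++ b)
Tsipℤ-insert a t tu j = Dyck-insert a (t j) (tu j)

Dyck? : ∀ f w → Dec (Dyck f w)
Dyck? f w = (weight f w ℤ.≟ 0ℤ) ×-dec allPrefixes? (λ p → 0ℤ ℤ.≤? weight f p) w

Tsipℤ? : ∀ w → Dec (Tsipℤ w)
Tsipℤ? w = all? (λ j → Dyck? δ[ j ] w)

nonEmpty? : ∀ w → Dec (NonEmpty w)
nonEmpty? []      = no λ ne → ne refl
nonEmpty? (_ ∷ _) = yes λ ()

-- Reductions

TsipFree : Word → Set
TsipFree y = ∀ u a b → NonEmpty u → a ++ u ++ b ≡ y → ¬ Tsipℤ u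

TsipFree-[] : TsipFree []
TsipFree-[] u a b u≢[] eq _ = u≢[] (++-conicalˡ u b (++-conicalʳ a (u ++ b) eq))

TsipFree-++⁻ʳ : ∀ x {y} → TsipFree (x ++ y) → TsipFree y
TsipFree-++⁻ʳ x free u a b u≢[] eq = free u (x ++ a) b u≢[] (trans (++-assoc x a (u ++ b)) (cong (x ++_) eq))

NoTsipPrefix : Word → Set
NoTsipPrefix y = ∀ p s → p ++ s ≡ y → NonEmpty p → ¬ Tsipℤ p

Reduced : List (Letter × Word) → Set
Reduced ps = AllTsip ps × TsipFree (letters ps)

Reduced-tail : ∀ {x u ps} → Reduced ((x , u) ∷ ps) → Reduced ps
Reduced-tail {x} ((_ , tps) , free) = tps , TsipFree-++⁻ʳ [ x ] free

flatten-++ : ∀ ps qs → flatten (ps ++ qs) ≡ flatten ps ++ flatten qs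
flatten-++ []             qs = refl
flatten-++ ((x , u) ∷ ps) qs =
  cong (x ∷_) (trans (cong (u ++_) (flatten-++ ps qs)) (sym (++-assoc u (flatten ps) (flatten qs))))

AllTsip-++⁻ : ∀ ps qs → AllTsip (ps ++ qs) → AllTsip ps × AllTsip qs
AllTsip-++⁻ []       qs tqs = tt , tqs
AllTsip-++⁻ (_ ∷ ps) qs (tu , tpqs) with AllTsip-++⁻ ps qs tpqs
... | tps , tqs = (tu , tps) , tqs

letters-++⁻ : ∀ ps p s → p ++ s ≡ letters ps →
  ∃₂ λ ps₁ ps₂ → ps ≡ ps₁ ++ ps₂ × letters ps₁ ≡ p × letters ps₂ ≡ s
letters-++⁻ ps             []      s eq = [] , ps , refl , refl , sym eq
letters-++⁻ []             (_ ∷ _) s ()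
letters-++⁻ ((x , u) ∷ ps) (_ ∷ p) s eq with ∷-injective eq
... | refl , eq′ with letters-++⁻ ps p s eq′
... | ps₁ , ps₂ , refl , refl , refl = (x , u) ∷ ps₁ , ps₂ , refl , refl , refl

tsip-expand : ∀ ps → AllTsip ps → ∀ c → Tsipℤ (c ++ letters ps) → Tsipℤ (c ++ flatten ps)
tsip-expand []             _          c t = t
tsip-expand ((x , u) ∷ ps) (tu , tps) c t =
  subst Tsipℤ (++-assoc c [ x ] (u ++ flatten ps))
    (Tsipℤ-insert (c ∷ʳ x) (tsip-expand ps tps (c ∷ʳ x) t′) (tsip⇒Tsipℤ tu))
  where
  t′ : Tsipℤ (c ∷ʳ x ++ letters ps)
  t′ = subst Tsipℤ (sym (++-assoc c [ x ] (letters ps))) t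

-- Complete words uᵢ inside s are deleted; a partially covered one is cut off, which
-- keeps c s tsip since prefixes of a tsip word have nonnegative colour heights.
tsip-contract : ∀ ps → AllTsip ps → ∀ c s {t} → s ++ t ≡ flatten ps → Tsipℤ (c ++ s) →
  ∃₂ λ y z → y ++ z ≡ letters ps × Tsipℤ (c ++ y) × (NonEmpty s → NonEmpty y)
tsip-contract ps _ c [] _ t = [] , letters ps , refl , t , λ s≢[] → ⊥-elim (s≢[] refl)
tsip-contract [] _ c (_ ∷ _) ()
tsip-contract ((x , u) ∷ ps) (tu , tps) c (_ ∷ s) eq t with ∷-injective eq
... | refl , eq′ with ++-prefix-cases u s eq′
...   | inj₁ (s′ , s++s′≡u , _) =
        [ x ] , letters ps , refl ,
        (λ j → Dyck-++⁻ˡ (c ∷ʳ x) (subst Tsipℤ (sym (++-assoc c [ x ] s)) t j)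
                          (proj₂ (tsip⇒Tsipℤ tu j) s s′ s++s′≡u)) ,
        λ _ ()
...   | inj₂ (s′ , refl , s′++t≡) with tsip-contract ps tps (c ∷ʳ x) s′ s′++t≡
          (Tsipℤ-delete (c ∷ʳ x) (subst Tsipℤ (sym (++-assoc c [ x ] (u ++ s′))) t) (tsip⇒Tsipℤ tu))
...     | y , z , y++z≡ , t′ , _ =
          x ∷ y , z , cong (x ∷_) y++z≡ , subst Tsipℤ (++-assoc c [ x ] y) t′ , λ _ ()

flatten-noTsipPrefix : ∀ {ps} → Reduced ps → NoTsipPrefix (flatten ps)
flatten-noTsipPrefix {ps} (tps , free) p s eq p≢[] tp with tsip-contract ps tps [] p eq tp
... | y , z , y++z≡ , ty , nonEmpty = free y [] z (nonEmpty p≢[]) y++z≡ ty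

-- Prepending x to a reduction w₀ x₁u₁ x₂u₂ ⋯ of y: if some nonempty prefix of
-- x x₁ x₂ ⋯ is tsip, its expansion (which contains w₀) becomes the new head;
-- otherwise x becomes a new letter carrying w₀.
reduction-exists : ∀ y → ∃₂ λ w₀ ps → Tsipℤ w₀ × Reduced ps × w₀ ++ flatten ps ≡ y
reduction-exists [] = [] , [] , Tsipℤ-[] , (tt , TsipFree-[]) , refl
reduction-exists (x ∷ y) with reduction-exists y
... | w₀ , ps , t₀ , (tps , free) , eq
    with shortestPrefix (λ p → nonEmpty? p ×-dec Tsipℤ? p) (x ∷ letters ps)
...   | inj₂ none = [] , (x , w₀) ∷ ps , Tsipℤ-[] , ((Tsipℤ⇒tsip t₀ , tps) , free′) , cong (x ∷_) eq
  where
  free′ : TsipFree (x ∷ letters ps)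
  free′ u []      b u≢[] eq′ tu = none u b eq′ (u≢[] , tu)
  free′ u (_ ∷ a) b u≢[] eq′ with ∷-injective eq′
  ... | refl , eq″ = free u a b u≢[] eq″
...   | inj₁ ([] , _ , _ , ([]≢[] , _) , _) = ⊥-elim ([]≢[] refl)
...   | inj₁ (_ ∷ p , s , eq′ , (_ , tp) , _) with ∷-injective eq′
...     | refl , p++s≡ with letters-++⁻ ps p s p++s≡
...       | ps₁ , ps₂ , refl , refl , refl with AllTsip-++⁻ ps₁ ps₂ tps
...         | tps₁ , tps₂ =
  x ∷ w₀ ++ flatten ps₁ , ps₂ ,
  Tsipℤ-insert [ x ] (tsip-expand ps₁ tps₁ [ x ] tp) t₀ ,
  (tps₂ , TsipFree-++⁻ʳ (letters ps₁) (subst TsipFree (sym p++s≡) free)) ,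
  cong (x ∷_) (begin
    (w₀ ++ flatten ps₁) ++ flatten ps₂ ≡⟨ ++-assoc w₀ (flatten ps₁) (flatten ps₂) ⟩
    w₀ ++ flatten ps₁ ++ flatten ps₂   ≡⟨ cong (w₀ ++_) (sym (flatten-++ ps₁ ps₂)) ⟩
    w₀ ++ flatten (ps₁ ++ ps₂)         ≡⟨ eq ⟩
    y                                  ∎)

tsip-gap≡[] : ∀ a {t s b} → Tsipℤ (a ++ t) → Tsipℤ a → t ++ s ≡ b → NoTsipPrefix b → t ≡ []
tsip-gap≡[] a {[]}    _    _  _  _  = refl
tsip-gap≡[] a {x ∷ t} tat ta eq nb = ⊥-elim (nb (x ∷ t) _ eq (λ ()) (Tsipℤ-delete [] tat ta))

tsip-head-unique : ∀ {a a′ b b′} → Tsipℤ a → Tsipℤ a′ → NoTsipPrefix b → NoTsipPrefix b′ →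
  a ++ b ≡ a′ ++ b′ → a ≡ a′
tsip-head-unique {a} {a′} ta ta′ nb nb′ eq with ++-prefix-cases a a′ (sym eq)
... | inj₁ (t , a′++t≡a , b′≡t++b) with tsip-gap≡[] a′ (subst Tsipℤ (sym a′++t≡a) ta) ta′ (sym b′≡t++b) nb′
...   | refl = trans (sym a′++t≡a) (++-identityʳ a′)
tsip-head-unique {a} {a′} ta ta′ nb nb′ eq | inj₂ (t , a′≡a++t , t++b′≡b)
    with tsip-gap≡[] a (subst Tsipℤ a′≡a++t ta′) ta t++b′≡b nb
...   | refl = sym (trans a′≡a++t (++-identityʳ a))

mutual
  reduction-unique : ∀ {w₀ w₀′} ps ps′ → Tsipℤ w₀ → Tsipℤ w₀′ → Reduced ps → Reduced ps′ →
    w₀ ++ flatten ps ≡ w₀′ ++ flatten ps′ → w₀ ≡ w₀′ × ps ≡ ps′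
  reduction-unique {w₀} ps ps′ t₀ t₀′ red red′ eq
    with tsip-head-unique t₀ t₀′ (flatten-noTsipPrefix red) (flatten-noTsipPrefix red′) eq
  ... | refl = refl , reduced-unique ps ps′ red red′ (++-cancelˡ w₀ (flatten ps) (flatten ps′) eq)

  reduced-unique : ∀ ps ps′ → Reduced ps → Reduced ps′ → flatten ps ≡ flatten ps′ → ps ≡ ps′
  reduced-unique []      []      _ _ _  = refl
  reduced-unique []      (_ ∷ _) _ _ ()
  reduced-unique (_ ∷ _) []      _ _ ()
  reduced-unique ((x , u) ∷ ps) ((_ , u′) ∷ ps′) red red′ eq with ∷-injective eq
  ... | refl , eq′ with reduction-unique ps ps′ (tsip⇒Tsipℤ (proj₁ (proj₁ red))) (tsip⇒Tsipℤ (proj₁ (proj₁ red′)))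
                          (Reduced-tail red) (Reduced-tail red′) eq′
  ... | refl , refl = refl

-- Primitive words

Primitive : Word → Set
Primitive w = height w ≡ 0ℤ × (∀ p s → p ++ s ≡ w → NonEmpty p → NonEmpty s → 0ℤ < height p)

height-[_]≢0 : ∀ x → height [ x ] ≢ 0ℤ
height-[ I _ ]≢0 ()
height-[ O _ ]≢0 ()

primitive⇒Dyck : ∀ {w} → Primitive w → Dyck δ w
primitive⇒Dyck {w} (w≡0 , proper) = w≡0 , prefixes
  where
  prefixes : AllPrefixes (λ p → 0ℤ ≤ height p) w
  prefixes []      s       eq = ℤP.≤-refl
  prefixes (x ∷ p) []      eq = ℤP.≤-reflexive (sym (trans (cong height (trans (sym (++-identityʳ (x ∷ p))) eq)) w≡0))
  prefixes (x ∷ p) (y ∷ s) eq = ℤP.<⇒≤ (proper (x ∷ p) (y ∷ s) eq (λ ()) (λ ()))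

primitive⇒unbreakable : ∀ x Y z → Primitive (x ∷ Y ∷ʳ z) → TsipFree Y → IsUnbreakable (x ∷ Y ∷ʳ z)
primitive⇒unbreakable x Y z prim@(X≡0 , proper) free =
  Dyck⇒opSeq (primitive⇒Dyck prim) , (λ ()) , onlyTsipFactor ,
  λ p s eq p≢[] s≢[] balanced →
    ℤP.<⇒≢ (proper p s eq p≢[] s≢[]) (sym (balanced⇒height≡0 p balanced))
  where
  X = x ∷ Y ∷ʳ z
  onlyTsipFactor : ∀ u → NonEmpty u → IsTsipSubWord u X → u ≡ X
  onlyTsipFactor u _    (_  , [] , [] , eq) = trans (sym (++-identityʳ u)) eq
  onlyTsipFactor u u≢[] (tu , [] , _ ∷ _ , eq) =
    ⊥-elim (ℤP.<⇒≢ (proper u _ eq u≢[] (λ ())) (sym (proj₁ (tsip⇒Dyck tu))))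
  onlyTsipFactor u u≢[] (tu , a@(_ ∷ _) , [] , eq) =
    ⊥-elim (ℤP.<⇒≢ (proper a u a++u≡X (λ ()) u≢[]) (sym a≡0))
    where
    a++u≡X : a ++ u ≡ X
    a++u≡X = trans (cong (a ++_) (sym (++-identityʳ u))) eq
    a≡0 : height a ≡ 0ℤ
    a≡0 = begin
      height a              ≡⟨ cong height (sym (++-identityʳ a)) ⟩
      height (a ++ [])      ≡⟨ sym (weight-cancel δ (proj₁ (tsip⇒Dyck tu)) a []) ⟩
      height (a ++ u ++ []) ≡⟨ cong height eq ⟩
      height X              ≡⟨ X≡0 ⟩
      0ℤ                    ∎
  onlyTsipFactor u u≢[] (tu , _ ∷ a , _ ∷ _ , eq) with ∷-injective eq
  ... | refl , eq′ with prefix-of-∷ʳ (a ++ u) Y z (trans (++-assoc a u _) eq′) (λ ())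
  ... | t , a++u++t≡Y = ⊥-elim (free u a t u≢[] (trans (sym (++-assoc a u t)) a++u++t≡Y) (tsip⇒Tsipℤ tu))

unbreakable⇒primitive : ∀ {w} → IsUnbreakable w → Primitive w
unbreakable⇒primitive (os , _ , _ , unbalanced) with opSeq⇒Dyck os
... | w≡0 , prefixes = w≡0 , λ p s eq p≢[] s≢[] →
      ℤP.≤∧≢⇒< (prefixes p s eq) (λ 0≡p → unbalanced p s eq p≢[] s≢[] (height≡0⇒balanced p (sym 0≡p)))

factor-length : ∀ (a u b : Word) {y} → a ++ u ++ b ≡ y → length u ℕ.≤ length y
factor-length a u b refl =
  ℕP.≤-trans (ℕP.m≤m+n (length u) (length b))
    (ℕP.≤-trans (ℕP.≤-reflexive (sym (length-++ u)))
      (ℕP.≤-trans (ℕP.m≤n+m _ (length a)) (ℕP.≤-reflexive (sym (length-++ a)))))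

unbreakable⇒tsipFree : ∀ x Y z → IsUnbreakable (x ∷ Y ∷ʳ z) → TsipFree Y
unbreakable⇒tsipFree x Y z (_ , _ , onlyTsipFactor , _) u a b u≢[] eq tu =
  ℕP.<-irrefl refl (ℕP.<-≤-trans Y<u (factor-length a u b eq))
  where
  u≡X : u ≡ x ∷ Y ∷ʳ z
  u≡X = onlyTsipFactor u u≢[] (Tsipℤ⇒tsip tu , x ∷ a , b ∷ʳ z ,
    cong (x ∷_) (begin
      a ++ u ++ b ∷ʳ z     ≡⟨ cong (a ++_) (sym (++-assoc u b [ z ])) ⟩
      a ++ (u ++ b) ∷ʳ z   ≡⟨ sym (++-assoc a (u ++ b) [ z ]) ⟩
      (a ++ u ++ b) ∷ʳ z   ≡⟨ cong (_∷ʳ z) eq ⟩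
      Y ∷ʳ z               ∎))
  Y<u : length Y ℕ.< length u
  Y<u rewrite u≡X | length-++ Y {[ z ]} = ℕ.s≤s (ℕP.m≤m+n (length Y) 1)

primitive-prefix-unique : ∀ {P P′ r r′} → Primitive P → Primitive P′ → NonEmpty P → NonEmpty P′ →
  P ++ r ≡ P′ ++ r′ → P ≡ P′
primitive-prefix-unique {P} {P′} (P≡0 , proper) (P′≡0 , proper′) P≢[] P′≢[] eq
  with ++-prefix-cases P P′ (sym eq)
... | inj₁ ([] , P′++[]≡P , _) = trans (sym P′++[]≡P) (++-identityʳ P′)
... | inj₁ (_ ∷ _ , P′++t≡P , _) = ⊥-elim (ℤP.<⇒≢ (proper P′ _ P′++t≡P P′≢[] (λ ())) (sym P′≡0))
... | inj₂ ([] , P′≡P++[] , _) = sym (trans P′≡P++[] (++-identityʳ P))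
... | inj₂ (_ ∷ _ , P′≡P++t , _) = ⊥-elim (ℤP.<⇒≢ (proper′ P _ (sym P′≡P++t) P≢[] (λ ())) (sym P≡0))

PrefixesAbove : Word → Word → Set
PrefixesAbove x y = ∀ p s → p ++ s ≡ x →
  ∃₂ λ q r → q ++ r ≡ y × height q ≤ height p × (NonEmpty p → NonEmpty q)

primitive-transfer : ∀ {x y} z → height x ≡ height y → PrefixesAbove x y →
  Primitive (y ∷ʳ z) → Primitive (x ∷ʳ z)
primitive-transfer {x} {y} z x≡y above (yz≡0 , proper) = xz≡0 , proper′
  where
  xz≡0 : height (x ∷ʳ z) ≡ 0ℤ
  xz≡0 = begin
    height (x ∷ʳ z)          ≡⟨ weight-++ δ x [ z ] ⟩
    height x + height [ z ]  ≡⟨ cong (_+ height [ z ]) x≡y ⟩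
    height y + height [ z ]  ≡⟨ sym (weight-++ δ y [ z ]) ⟩
    height (y ∷ʳ z)          ≡⟨ yz≡0 ⟩
    0ℤ                       ∎
  proper′ : ∀ p s → p ++ s ≡ x ∷ʳ z → NonEmpty p → NonEmpty s → 0ℤ < height p
  proper′ p s eq p≢[] s≢[] with prefix-of-∷ʳ p x z eq s≢[]
  ... | t , p++t≡x with above p t p++t≡x
  ... | q , r , q++r≡y , q≤p , nonEmpty = ℤP.<-≤-trans
        (proper q (r ∷ʳ z) (trans (sym (++-assoc q r [ z ])) (cong (_∷ʳ z) q++r≡y)) (nonEmpty p≢[]) (∷ʳ-≢-[] r z))
        q≤p

tsip-height-++ : ∀ u {b} → IsTsip u → height (u ++ b) ≡ height b
tsip-height-++ u {b} tu = weight-cancel δ {u} (proj₁ (tsip⇒Dyck {u} tu)) [] b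

height-flatten : ∀ ps → AllTsip ps → height (flatten ps) ≡ height (letters ps)
height-flatten []             _          = refl
height-flatten ((x , u) ∷ ps) (tu , tps) =
  cong (_+_ (δ x)) (trans (tsip-height-++ u tu) (height-flatten ps tps))

flatten-above-letters : ∀ ps → AllTsip ps → PrefixesAbove (flatten ps) (letters ps)
flatten-above-letters ps _ [] _ _ = [] , letters ps , refl , ℤP.≤-refl , λ []≢[] → ⊥-elim ([]≢[] refl)
flatten-above-letters [] _ (_ ∷ _) _ ()
flatten-above-letters ((x , u) ∷ ps) (tu , tps) (_ ∷ p) s eq with ∷-injective eq
... | refl , eq′ with ++-prefix-cases u p eq′
...   | inj₁ (t , p++t≡u , _) =
        [ x ] , letters ps , refl , ℤP.+-monoʳ-≤ (δ x) (proj₂ (tsip⇒Dyck tu) p t p++t≡u) , λ _ ()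
...   | inj₂ (p′ , refl , p′++s≡) with flatten-above-letters ps tps p′ s p′++s≡
...     | q , r , q++r≡ , q≤p′ , _ =
          x ∷ q , r , cong (x ∷_) q++r≡ ,
          ℤP.+-monoʳ-≤ (δ x) (ℤP.≤-trans q≤p′ (ℤP.≤-reflexive (sym (tsip-height-++ u tu)))) ,
          λ _ ()

letters-above-flatten : ∀ ps → AllTsip ps → PrefixesAbove (letters ps) (flatten ps)
letters-above-flatten ps _ [] _ _ = [] , flatten ps , refl , ℤP.≤-refl , λ []≢[] → ⊥-elim ([]≢[] refl)
letters-above-flatten [] _ (_ ∷ _) _ ()
letters-above-flatten ((x , u) ∷ ps) (tu , tps) (_ ∷ q) s eq with ∷-injective eq
... | refl , eq′ with letters-above-flatten ps tps q s eq′
... | p , r , p++r≡ , p≤q , _ =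
      x ∷ u ++ p , r , cong (x ∷_) (trans (++-assoc u p r) (cong (u ++_) p++r≡)) ,
      ℤP.+-monoʳ-≤ (δ x) (ℤP.≤-trans (ℤP.≤-reflexive (tsip-height-++ u tu)) p≤q) ,
      λ _ ()

primitive-letters⇒flatten : ∀ ps z → AllTsip ps → Primitive (letters ps ∷ʳ z) → Primitive (flatten ps ∷ʳ z)
primitive-letters⇒flatten ps z tps =
  primitive-transfer z (height-flatten ps tps) (flatten-above-letters ps tps)

primitive-flatten⇒letters : ∀ ps z → AllTsip ps → Primitive (flatten ps ∷ʳ z) → Primitive (letters ps ∷ʳ z)
primitive-flatten⇒letters ps z tps =
  primitive-transfer z (sym (height-flatten ps tps)) (letters-above-flatten ps tps)

first-primitive-prefix : ∀ w → IsOpSeq w → NonEmpty w →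
  ∃₂ λ P v → P ++ v ≡ w × Primitive P × NonEmpty P × IsOpSeq v
first-primitive-prefix w os w≢[]
  with opSeq⇒Dyck os | shortestPrefix (λ p → nonEmpty? p ×-dec (height p ℤ.≟ 0ℤ)) w
... | w≡0 , _        | inj₂ none = ⊥-elim (none w [] (++-identityʳ w) (w≢[] , w≡0))
... | w≡0 , prefixes | inj₁ (P , v , P++v≡w , (P≢[] , P≡0) , shortest) =
  P , v , P++v≡w , (P≡0 , proper) , P≢[] , Dyck⇒opSeq (v≡0 , v-prefixes)
  where
  height-P++ : ∀ b → height (P ++ b) ≡ height b
  height-P++ = weight-cancel δ {P} P≡0 []
  proper : ∀ p s → p ++ s ≡ P → NonEmpty p → NonEmpty s → 0ℤ < height p
  proper p s eq p≢[] s≢[] = ℤP.≤∧≢⇒<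
    (prefixes p (s ++ v) (trans (sym (++-assoc p s v)) (trans (cong (_++ v) eq) P++v≡w)))
    (λ 0≡p → shortest p s eq s≢[] (p≢[] , sym 0≡p))
  v≡0 : height v ≡ 0ℤ
  v≡0 = trans (sym (height-P++ v)) (trans (cong height P++v≡w) w≡0)
  v-prefixes : AllPrefixes (λ p → 0ℤ ≤ height p) v
  v-prefixes p s eq = subst (0ℤ ≤_) (height-P++ p)
    (prefixes (P ++ p) s (trans (++-assoc P p s) (trans (cong (P ++_) eq) P++v≡w)))

primitive-ends : ∀ P → Primitive P → NonEmpty P → ∃₂ λ x Q → ∃ λ z → P ≡ x ∷ Q ∷ʳ z
primitive-ends P (P≡0 , _) P≢[] with initLast P
... | []              = ⊥-elim (P≢[] refl)
... | [] ∷ʳ′ z        = ⊥-elim (height-[ z ]≢0 P≡0)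
... | (x ∷ Q) ∷ʳ′ z   = x , Q , z , refl

length≡#I+#O : ∀ w → length w ≡ #I w ℕ.+ #O w
length≡#I+#O []        = refl
length≡#I+#O (I _ ∷ w) = cong ℕ.suc (length≡#I+#O w)
length≡#I+#O (O _ ∷ w) = trans (cong ℕ.suc (length≡#I+#O w)) (sym (ℕP.+-suc (#I w) (#O w)))

balanced-length : ∀ {w} → #I w ≡ #O w → length w ≡ 2 ℕ.* #I w
balanced-length {w} I≡O =
  trans (length≡#I+#O w) (cong (#I w ℕ.+_) (trans (sym I≡O) (sym (ℕP.+-identityʳ (#I w)))))

length-letters-∷ʳ : ∀ ps z → length (letters ps ∷ʳ z) ≡ ℕ.suc (length ps)
length-letters-∷ʳ []       z = refl
length-letters-∷ʳ (_ ∷ ps) z = cong ℕ.suc (length-letters-∷ʳ ps z)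

suc≡2*⇒0< : ∀ {k} m → ℕ.suc k ≡ 2 ℕ.* m → 0 ℕ.< m
suc≡2*⇒0< (ℕ.suc m) _ = ℕ.s≤s ℕ.z≤n

decomposition-exists : ∀ w → IsOpSeq w → NonEmpty w → Σ Decomp (IsDecompOf w)
decomposition-exists w os w≢[] with first-primitive-prefix w os w≢[]
... | P , v , P++v≡w , prim , P≢[] , os-v with primitive-ends P prim P≢[]
... | x , Q , z , refl with reduction-exists Q
... | w₀ , ps , t₀ , (tps , free) , w₀++flatten≡Q =
  decomp (#I X) qs z v , suc≡2*⇒0< (#I X) length-qs , length-qs , unbreakable , tqs , os-v , flatten-qs
  where
  qs : List (Letter × Word)
  qs = (x , w₀) ∷ ps
  tqs : AllTsip qs
  tqs = Tsipℤ⇒tsip t₀ , tps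
  X : Word
  X = letters qs ∷ʳ z
  unbreakable : IsUnbreakable X
  unbreakable = primitive⇒unbreakable x (letters ps) z
    (primitive-flatten⇒letters qs z tqs (subst (λ Q → Primitive (x ∷ Q ∷ʳ z)) (sym w₀++flatten≡Q) prim))
    free
  length-qs : ℕ.suc (length qs) ≡ 2 ℕ.* #I X
  length-qs = trans (sym (length-letters-∷ʳ qs z)) (balanced-length {X} (proj₁ (proj₁ unbreakable)))
  flatten-qs : flatten qs ++ z ∷ v ≡ w
  flatten-qs = trans (cong (x ∷_) (begin
    (w₀ ++ flatten ps) ++ z ∷ v ≡⟨ cong (_++ z ∷ v) w₀++flatten≡Q ⟩
    Q ++ z ∷ v                 ≡⟨ sym (++-assoc Q [ z ] v) ⟩
    (Q ∷ʳ z) ++ v              ∎)) P++v≡w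

decomposition-primitive : ∀ {w} d → IsDecompOf w d → Primitive (flatten (pairs d) ∷ʳ lastX d)
decomposition-primitive d (_ , _ , unbreakable , tqs , _) =
  primitive-letters⇒flatten (pairs d) (lastX d) tqs (unbreakable⇒primitive unbreakable)

pairs-unique : ∀ qs qs′ {z z′} → AllTsip qs → AllTsip qs′ →
  IsUnbreakable (letters qs ∷ʳ z) → IsUnbreakable (letters qs′ ∷ʳ z′) → flatten qs ≡ flatten qs′ → qs ≡ qs′
pairs-unique []      []      _ _ _ _ _  = refl
pairs-unique []      (_ ∷ _) _ _ _ _ ()
pairs-unique (_ ∷ _) []      _ _ _ _ ()
pairs-unique ((x , u) ∷ ps) ((_ , u′) ∷ ps′) {z} {z′} (tu , tps) (tu′ , tps′) unb unb′ eq
  with ∷-injective eq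
... | refl , eq′ with reduction-unique ps ps′ (tsip⇒Tsipℤ tu) (tsip⇒Tsipℤ tu′)
                        (tps , unbreakable⇒tsipFree x (letters ps) z unb)
                        (tps′ , unbreakable⇒tsipFree x (letters ps′) z′ unb′) eq′
... | refl , refl = refl

decomposition-unique : ∀ {w} d d′ → IsDecompOf w d → IsDecompOf w d′ → d ≡ d′
decomposition-unique d@(decomp m qs z v) d′@(decomp m′ qs′ z′ v′)
  dec@(_ , len , unb , tqs , _ , eq) dec′@(_ , len′ , unb′ , tqs′ , _ , eq′)
  with primitive-prefix-unique (decomposition-primitive d dec) (decomposition-primitive d′ dec′)
         (∷ʳ-≢-[] (flatten qs) z) (∷ʳ-≢-[] (flatten qs′) z′)
         (trans (++-assoc (flatten qs) [ z ] v) (trans eq (sym (trans (++-assoc (flatten qs′) [ z′ ] v′) eq′))))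
... | P≡P′ with ∷ʳ-injective (flatten qs) (flatten qs′) P≡P′
... | flatten≡ , refl with pairs-unique qs qs′ tqs tqs′ unb unb′ flatten≡
... | refl with ∷-injective (++-cancelˡ (flatten qs) (z ∷ v) (z ∷ v′) (trans eq (sym eq′)))
... | _ , refl with ℕP.*-cancelˡ-≡ m m′ 2 (trans (sym len) len′)
... | refl = refl

mainTheorem9 : (w : Word) → IsOpSeq w → NonEmpty w →
    ∃! _≡_ (λ (d : Decomp) → IsDecompOf w d)
mainTheorem9 w os w≢[] with decomposition-exists w os w≢[]
... | d , isDecomp = d , isDecomp , λ {d′} → decomposition-unique d d′ isDecomp
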